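{- Let $w_0\in\mathcal{A}^{\mathbb{N}}$ and $w_1\in\mathcal{B}^{\mathbb{N}}$ be two infinite words over disjoint finite alphabets $\mathcal{A},\mathcal{B}$. If there exists $k\in\mathbb{N}_{>0}$ such that $b^k_{w_0}=p_{w_0}$ and $b^k_{w_1}=p_{w_1}$, then for every letter $a\in\mathcal{A}$, the $k$-binomial complexity of $\mathtt{color}(w_0,a,w_1)$ coincides with its subword complexity.
   Context: For finite words $u,x$, $\binom{u}{x}$ is the number of occurrences of $x$ in $u$ as a scattered subword ($\binom{u}{\epsilon}=1$); $u,v$ are $k$-binomially equivalent if $\binom{u}{x}=\binom{v}{x}$ for all words $x$ of length at most $k$. For an infinite word $w$, $p_w(n)$ is the number of distinct factors of length $n$ and $b^k_w(n)$ is the number of $k$-binomial equivalence classes of factors of length $n$. Coloring: for $a\in\mathcal{A}$, $\mathtt{color}(w_0,a,w_1)\in(\mathcal{A}\sqcup\mathcal{B}\setminus\{a\})^{\mathbb{N}}$ is defined (indexing from $0$) by $\mathtt{color}(w_0,a,w_1)[n]=w_0[n]$ if $w_0[n]\neq a$, and $=w_1[k'-1]$ if $w_0[n]=a$ and $a$ occurs exactly $k'$ times in $w_0[0]\cdots w_0[n]$. -}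

module Defs where

open import Data.Nat using (ℕ; zero; suc; _+_; _∸_; _≤_; _<_)
open import Data.Fin using (Fin) renaming (_≟_ to _≟F_)
open import Data.Sum using (_⊎_; inj₁; inj₂)
open import Data.Sum.Properties using (≡-dec)
open import Data.List using (List; []; _∷_; length)
open import Data.List.Relation.Unary.All using (All)
open import Data.List.Relation.Unary.Any using (Any)
open import Data.List.Relation.Unary.AllPairs using (AllPairs)
open import Data.List.Membership.Propositional using (_∈_)
open import Data.Product using (Σ; ∃; _×_)
open import Relation.Binary.PropositionalEquality using (_≡_; _≢_)
open import Relation.Binary.Definitions using (DecidableEquality)
open import Relation.Nullary using (¬_; yes; no)

Word : Set → Set
Word A = ℕ → A

binom : {A : Set} → DecidableEquality A → List A → List A → ℕ
binom _≟_ u [] = 1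
binom _≟_ [] (x ∷ xs) = 0
binom _≟_ (y ∷ u) (x ∷ xs) with x ≟ y
... | yes _ = binom _≟_ u xs + binom _≟_ u (x ∷ xs)
... | no _ = binom _≟_ u (x ∷ xs)

BinEquiv : {A : Set} → DecidableEquality A → ℕ → List A → List A → Set
BinEquiv _≟_ k u v = (x : List _) → length x ≤ k → binom _≟_ u x ≡ binom _≟_ v x

factor : {A : Set} → Word A → ℕ → ℕ → List A
factor w i zero = []
factor w i (suc n) = w i ∷ factor w (suc i) n

IsFactor : {A : Set} → Word A → ℕ → List A → Set
IsFactor w n u = ∃ λ i → factor w i n ≡ u

SubwordComplexity : {A : Set} → Word A → ℕ → ℕ → Set
SubwordComplexity w n m =
  Σ (List _) λ L → length L ≡ m × AllPairs _≢_ L × All (IsFactor w n) L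
    × ((u : List _) → IsFactor w n u → u ∈ L)

BinomialComplexity : {A : Set} → DecidableEquality A → ℕ → Word A → ℕ → ℕ → Set
BinomialComplexity _≟_ k w n m =
  Σ (List _) λ L → length L ≡ m
    × AllPairs (λ u v → ¬ BinEquiv _≟_ k u v) L × All (IsFactor w n) L
    × ((u : List _) → IsFactor w n u → Any (BinEquiv _≟_ k u) L)

BinEqSubword : {A : Set} → DecidableEquality A → ℕ → Word A → Set
BinEqSubword _≟_ k w = (n m₁ m₂ : ℕ) → SubwordComplexity w n m₁ →
  BinomialComplexity _≟_ k w n m₂ → m₁ ≡ m₂

countUpTo : {A : Set} → DecidableEquality A → Word A → A → ℕ → ℕ
countUpTo _≟_ w a zero with w zero ≟ a
... | yes _ = 1
... | no _ = 0
countUpTo _≟_ w a (suc n) with w (suc n) ≟ a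
... | yes _ = suc (countUpTo _≟_ w a n)
... | no _ = countUpTo _≟_ w a n

color : {p q : ℕ} → Word (Fin p) → Fin p → Word (Fin q) → Word (Fin p ⊎ Fin q)
color w₀ a w₁ n with w₀ n ≟F a
... | yes _ = inj₂ (w₁ (countUpTo _≟F_ w₀ a n ∸ 1))
... | no _ = inj₁ (w₀ n)

decSum : {p q : ℕ} → DecidableEquality (Fin p ⊎ Fin q)
decSum = ≡-dec _≟F_ _≟F_

-- b^k_w = p_w says exactly that k-binomially equivalent factors of w of the same length are equal:
-- the binomial classes are unions of factors, and two distinct equivalent factors would make
-- them strictly fewer. This property passes to color(w₀, a, w₁): replacing every letter of the
-- second alphabet by a sends a factor of the colored word to the factor of w₀ at the same
-- position, deleting the letters of the first alphabet sends it to a factor of w₁, both maps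
-- preserve k-binomial equivalence, and the two images together determine the factor.
module Submission where

open import Defs
open import Data.Nat using (ℕ; zero; suc; _+_; _*_; _∸_; _≤_; _<_; s≤s)
open import Data.Nat.Properties using (_≤?_; <-irrefl; *-identityˡ; module ≤-Reasoning)
  renaming (_≟_ to _≟ℕ_)
open import Data.Nat.ListAction using (sum)
open import Data.Nat.ListAction.Properties using (sum-++)
open import Data.Nat.Tactic.RingSolver using (solve-∀)
open import Data.Fin using (Fin; _≟_)
open import Data.Sum using (_⊎_; inj₁; inj₂; [_,_]′; isInj₂)
open import Data.Sum.Properties using (inj₂-injective) renaming (≡-dec to ⊎-≡-dec)
open import Data.List using (List; []; _∷_; [_]; _++_; length; map; filter; mapMaybe;
  deduplicate; cartesianProductWith; concatMap; allFin; upTo)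
open import Data.List.Properties using (≡-dec; map-++; map-∘; map-cong; map-cong-local;
  length-map; ∷-injective; filter-accept; filter-notAll; filter-none; length-filter;
  length-deduplicate)
open import Data.List.Relation.Unary.All as All using (All; []; _∷_)
import Data.List.Relation.Unary.All.Properties as All
open import Data.List.Relation.Unary.Any as Any using (Any; here; there)
import Data.List.Relation.Unary.Any.Properties as Any
open import Data.List.Relation.Unary.AllPairs as AllPairs using (AllPairs)
open import Data.List.Relation.Unary.Unique.Propositional using (Unique; []; _∷_)
import Data.List.Relation.Unary.Unique.Propositional.Properties as Unique
import Data.List.Relation.Unary.Unique.DecSetoid.Properties as DecSetoidUnique
import Data.List.Relation.Unary.Unique.DecPropositional.Properties as DecPropUnique
open import Data.List.Membership.Propositional using (_∈_; _∉_; find; lose)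
open import Data.List.Membership.Propositional.Properties using (∈-map⁺; ∈-map⁻; ∈-allFin;
  ∈-upTo⁺; ∈-concatMap⁺; ∈-cartesianProductWith⁺; ∈-cartesianProductWith⁻; ∈-deduplicate⁺)
open import Data.List.Membership.Propositional.Properties.WithK using (unique∧set⇒bag)
open import Data.List.Relation.Binary.BagAndSetEquality using (∼bag⇒↭)
open import Data.List.Relation.Binary.Permutation.Propositional.Properties using (↭-length)
open import Data.Product using (Σ; _×_; _,_; proj₁; proj₂)
open import Data.Empty using (⊥-elim)
open import Function using (id; const; _∘_; mk⇔)
open import Relation.Nullary using (¬_; yes; no; ¬?)
open import Relation.Nullary.Decidable using (map′; _→-dec_; ¬¬-excluded-middle)
open import Relation.Binary using (IsEquivalence; DecSetoid)
open import Relation.Binary.Definitions using (DecidableEquality; Decidable)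
open import Relation.Binary.PropositionalEquality using (_≡_; _≢_; refl; sym; trans; cong; cong₂;
  subst; subst₂; ≢-sym; module ≡-Reasoning)

private
  variable
    A B : Set

binom-[] : (_≟A_ : DecidableEquality A) (u : List A) → binom _≟A_ u [] ≡ 1
binom-[] _ [] = refl
binom-[] _ (_ ∷ _) = refl

length-factor : (w : Word A) (i n : ℕ) → length (factor w i n) ≡ n
length-factor w i zero = refl
length-factor w i (suc n) = cong suc (length-factor w (suc i) n)

module _ (_≟A_ : DecidableEquality A) (k : ℕ) where

  binEquiv-isEquivalence : IsEquivalence (BinEquiv _≟A_ k)
  binEquiv-isEquivalence = record
    { refl  = λ _ _ → refl
    ; sym   = λ e x l → sym (e x l)
    ; trans = λ e f x l → trans (e x l) (f x l)
    }

  BinInjective : Word A → Set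
  BinInjective w = ∀ n i j → BinEquiv _≟A_ k (factor w i n) (factor w j n) →
    factor w i n ≡ factor w j n

  open IsEquivalence binEquiv-isEquivalence using () renaming (refl to binEquiv-refl)

  binInjective⇒binEqSubword : ∀ w → BinInjective w → BinEqSubword _≟A_ k w
  binInjective⇒binEqSubword w inj n _ _ (L₁ , refl , L₁! , L₁-factors , L₁-complete)
                                         (L₂ , refl , L₂-sep , L₂-factors , L₂-complete) =
    ↭-length (∼bag⇒↭ (unique∧set⇒bag L₁! L₂! (mk⇔ L₁⊆L₂ L₂⊆L₁)))
    where
    factors-equal : ∀ {u v} → IsFactor w n u → IsFactor w n v → BinEquiv _≟A_ k u v → u ≡ v
    factors-equal (i , refl) (j , refl) = inj n i j
    L₂! : Unique L₂
    L₂! = AllPairs.map (λ { ¬e refl → ¬e binEquiv-refl }) L₂-sep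
    L₂⊆L₁ : ∀ {u} → u ∈ L₂ → u ∈ L₁
    L₂⊆L₁ u∈ = L₁-complete _ (All.lookup L₂-factors u∈)
    L₁⊆L₂ : ∀ {u} → u ∈ L₁ → u ∈ L₂
    L₁⊆L₂ u∈ with u-factor ← All.lookup L₁-factors u∈
            with v , v∈ , u≈v ← find (L₂-complete _ u-factor)
      rewrite factors-equal u-factor (All.lookup L₂-factors v∈) u≈v = v∈

¬¬-filter : (P : A → Set) (xs : List A) →
  ¬ ¬ Σ (List A) λ ys → All P ys × (∀ {x} → x ∈ xs → P x → x ∈ ys)
¬¬-filter P [] k = k ([] , [] , λ ())
¬¬-filter P (x ∷ xs) k = ¬¬-excluded-middle λ
  { (yes px) → ¬¬-filter P xs λ (ys , all , complete) →
      k (x ∷ ys , px ∷ all , λ { (here refl) _ → here refl ; (there x∈) → there ∘ complete x∈ })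
  ; (no ¬px) → ¬¬-filter P xs λ (ys , all , complete) →
      k (ys , all , λ { (here refl) px → ⊥-elim (¬px px) ; (there x∈) → complete x∈ })
  }

module _ {R : A → A → Set} (R? : Decidable R) where

  length-deduplicate-< : ∀ {x y} zs → R x y →
    length (deduplicate R? (x ∷ y ∷ zs)) < length (x ∷ y ∷ zs)
  length-deduplicate-< {x} {y} zs r = s≤s (begin-strict
    length (filter (¬? ∘ R? x) (deduplicate R? (y ∷ zs)))
      <⟨ filter-notAll (¬? ∘ R? x) _ (here (λ ¬r → ¬r r)) ⟩
    suc (length (filter (¬? ∘ R? y) (deduplicate R? zs)))
      ≤⟨ s≤s (length-filter (¬? ∘ R? y) (deduplicate R? zs)) ⟩
    suc (length (deduplicate R? zs))
      ≤⟨ s≤s (length-deduplicate R? zs) ⟩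
    suc (length zs) ∎)
    where open ≤-Reasoning

deduplicate-≢ : (_≟A_ : DecidableEquality A) {x y : A} (zs : List A) → x ≢ y →
  Σ (List A) λ rest → deduplicate _≟A_ (x ∷ y ∷ zs) ≡ x ∷ y ∷ rest
deduplicate-≢ _≟A_ zs x≢y = _ , cong (_ ∷_) (filter-accept (¬? ∘ (_ ≟A_)) x≢y)

module _ {p : ℕ} where

  words : ℕ → List (List (Fin p))
  words zero = [ [] ]
  words (suc n) = cartesianProductWith _∷_ (allFin p) (words n)

  ∈-words : (u : List (Fin p)) → u ∈ words (length u)
  ∈-words [] = here refl
  ∈-words (c ∷ u) = ∈-cartesianProductWith⁺ _∷_ (∈-allFin c) (∈-words u)

  wordsUpTo : ℕ → List (List (Fin p))
  wordsUpTo k = concatMap words (upTo (suc k))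

  ∈-wordsUpTo : ∀ {k} u → length u ≤ k → u ∈ wordsUpTo k
  ∈-wordsUpTo u l = ∈-concatMap⁺ words (lose (∈-upTo⁺ (s≤s l)) (∈-words u))

  binEquiv? : ∀ k → Decidable (BinEquiv _≟_ k)
  binEquiv? k u v = map′
    (λ all x l → All.lookup all (∈-wordsUpTo x l) l)
    (λ e → All.tabulate λ {x} _ l → e x l)
    (All.all? (λ x → length x ≤? k →-dec binom _≟_ u x ≟ℕ binom _≟_ v x) (wordsUpTo k))

  binEquiv-decSetoid : ℕ → DecSetoid _ _
  binEquiv-decSetoid k = record
    { Carrier = List (Fin p)
    ; _≈_ = BinEquiv _≟_ k
    ; isDecEquivalence = record
      { isEquivalence = binEquiv-isEquivalence _≟_ k
      ; _≟_ = binEquiv? k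
      }
    }

-- Being a factor of w is undecidable, but the goal is ⊥, so we may split classically on the
-- finitely many words of length n and list the factors of that length.
binEqSubword⇒binInjective : ∀ {p} k (w : Word (Fin p)) →
  BinEqSubword _≟_ k w → BinInjective _≟_ k w
binEqSubword⇒binInjective {p} k w b=p n i j u≈v with ≡-dec _≟_ (factor w i n) (factor w j n)
... | yes u≡v = u≡v
... | no u≢v = ⊥-elim (¬¬-filter (IsFactor w n) (words n) no-factor-list)
  where
  no-factor-list : ¬ Σ (List _) λ F → All (IsFactor w n) F ×
    (∀ {y} → y ∈ words n → IsFactor w n y → y ∈ F)
  no-factor-list (F , F-factors , F-complete) = <-irrefl (sym (b=p n _ _
    (L₁ , refl , L₁! , L₁-factors , L₁-complete)
    (L₂ , refl , L₂-sep , All.deduplicate⁺ (binEquiv? k) L₁-factors , L₂-complete))) L₂<L₁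
    where
    L₁ L₂ : List (List (Fin p))
    L₁ = deduplicate (≡-dec _≟_) (factor w i n ∷ factor w j n ∷ F)
    L₂ = deduplicate (binEquiv? k) L₁
    L₁! : Unique L₁
    L₁! = DecPropUnique.deduplicate-! (≡-dec _≟_) (factor w i n ∷ factor w j n ∷ F)
    L₂-sep : AllPairs (λ u v → ¬ BinEquiv _≟_ k u v) L₂
    L₂-sep = DecSetoidUnique.deduplicate-! (binEquiv-decSetoid k) L₁
    L₁-factors : All (IsFactor w n) L₁
    L₁-factors = All.deduplicate⁺ (≡-dec _≟_) ((i , refl) ∷ (j , refl) ∷ F-factors)
    L₁-complete : (y : List (Fin p)) → IsFactor w n y → y ∈ L₁
    L₁-complete y y-factor@(m , refl) = ∈-deduplicate⁺ (≡-dec _≟_) (there (there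
      (F-complete (subst (λ l → y ∈ words l) (length-factor w m n) (∈-words y)) y-factor)))
    L₂-complete : (y : List (Fin p)) → IsFactor w n y → Any (BinEquiv _≟_ k y) L₂
    L₂-complete y y-factor = Any.deduplicate⁺ (binEquiv? k) (λ r e x l → trans (e x l) (sym (r x l)))
      (Any.map (λ { refl → λ _ _ → refl }) (L₁-complete y y-factor))
    L₂<L₁ : length L₂ < length L₁
    L₂<L₁ with rest , L₁≡ ← deduplicate-≢ (≡-dec _≟_) F u≢v =
      subst (λ L → length (deduplicate (binEquiv? k) L) < length L) (sym L₁≡)
        (length-deduplicate-< (binEquiv? k) rest u≈v)

sum-map-cartesianProduct-∷ : {C : Set} (g : List C → ℕ) (S : List C) (W : List (List C)) →
  sum (map g (cartesianProductWith _∷_ S W)) ≡ sum (map (λ c → sum (map (g ∘ (c ∷_)) W)) S)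
sum-map-cartesianProduct-∷ g [] W = refl
sum-map-cartesianProduct-∷ g (c ∷ S) W = begin
  sum (map g (map (c ∷_) W ++ cartesianProductWith _∷_ S W))
    ≡⟨ cong sum (map-++ g (map (c ∷_) W) _) ⟩
  sum (map g (map (c ∷_) W) ++ map g (cartesianProductWith _∷_ S W))
    ≡⟨ sum-++ (map g (map (c ∷_) W)) _ ⟩
  sum (map g (map (c ∷_) W)) + sum (map g (cartesianProductWith _∷_ S W))
    ≡⟨ cong₂ _+_ (cong sum (sym (map-∘ W))) (sum-map-cartesianProduct-∷ g S W) ⟩
  sum (map (g ∘ (c ∷_)) W) + sum (map (λ c → sum (map (g ∘ (c ∷_)) W)) S) ∎
  where open ≡-Reasoning

sum-map-+ : {X : Set} (g h : X → ℕ) (xs : List X) →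
  sum (map (λ x → g x + h x) xs) ≡ sum (map g xs) + sum (map h xs)
sum-map-+ g h [] = refl
sum-map-+ g h (x ∷ xs) = trans (cong (g x + h x +_) (sum-map-+ g h xs))
  (interchange (g x) (h x) (sum (map g xs)) (sum (map h xs)))
  where
  interchange : ∀ a b c d → a + b + (c + d) ≡ a + c + (b + d)
  interchange = solve-∀

sum-map-0 : {X : Set} (xs : List X) → sum (map (λ _ → 0) xs) ≡ 0
sum-map-0 [] = refl
sum-map-0 (_ ∷ xs) = sum-map-0 xs

module _ (_≟A_ : DecidableEquality A) where

  length-filter-∉ : ∀ {y xs} → y ∉ xs → length (filter (_≟A y) xs) ≡ 0
  length-filter-∉ {y} {xs} y∉ = cong length (filter-none (_≟A y)
    (All.tabulate λ x∈ x≡y → y∉ (subst (_∈ xs) x≡y x∈)))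

  length-filter-∈ : ∀ {y xs} → Unique xs → y ∈ xs → length (filter (_≟A y) xs) ≡ 1
  length-filter-∈ {y} {x ∷ xs} (x∉xs ∷ xs!) y∈ with x ≟A y | y∈
  ... | yes refl | _ = cong suc (length-filter-∉ λ x∈xs → All.lookup x∉xs x∈xs refl)
  ... | no x≢y | here y≡x = ⊥-elim (x≢y (sym y≡x))
  ... | no _ | there y∈xs = length-filter-∈ xs! y∈xs

module LetterMorphism {C D : Set} (_≟C_ : DecidableEquality C) (_≟D_ : DecidableEquality D)
  (f : C → D) (fibre : D → List C) (fibre-unique : ∀ b → Unique (fibre b))
  (fibre-sound : ∀ {y b} → y ∈ fibre b → f y ≡ b) (fibre-complete : ∀ y → y ∈ fibre (f y))
  where

  open ≡-Reasoning

  fibre-hit : ∀ y → length (filter (_≟C y) (fibre (f y))) ≡ 1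
  fibre-hit y = length-filter-∈ _≟C_ (fibre-unique (f y)) (fibre-complete y)

  fibre-miss : ∀ {y b} → f y ≢ b → length (filter (_≟C y) (fibre b)) ≡ 0
  fibre-miss fy≢b = length-filter-∉ _≟C_ (fy≢b ∘ fibre-sound)

  fibres : List D → List (List C)
  fibres [] = [ [] ]
  fibres (b ∷ x) = cartesianProductWith _∷_ (fibre b) (fibres x)

  length-fibres : ∀ x → All (λ z → length z ≡ length x) (fibres x)
  length-fibres [] = refl ∷ []
  length-fibres (b ∷ x) = All.tabulate λ z∈ →
    let _ , _ , _ , z′∈ , z≡ = ∈-cartesianProductWith⁻ _∷_ (fibre b) (fibres x) z∈
    in subst (λ z → length z ≡ suc (length x)) (sym z≡) (cong suc (All.lookup (length-fibres x) z′∈))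

  private
    bin : List C → List C → ℕ
    bin = binom _≟C_

    sum-binom-∷ʳ : List C → List C → List (List C) → ℕ
    sum-binom-∷ʳ v S W = sum (map (λ c → sum (map (λ z → bin v (c ∷ z)) W)) S)

  sum-binom-∷ : ∀ y u S W →
    sum-binom-∷ʳ (y ∷ u) S W ≡ length (filter (_≟C y) S) * sum (map (bin u) W) + sum-binom-∷ʳ u S W
  sum-binom-∷ y u [] W = refl
  sum-binom-∷ y u (c ∷ S) W with c ≟C y
  ... | yes refl = begin
    sum (map (λ z → bin u z + bin u (y ∷ z)) W) + sum-binom-∷ʳ (y ∷ u) S W
      ≡⟨ cong₂ _+_ (sum-map-+ (bin u) _ W) (sum-binom-∷ y u S W) ⟩
    sum (map (bin u) W) + sum (map (bin u ∘ (y ∷_)) W) +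
      (length (filter (_≟C y) S) * sum (map (bin u) W) + sum-binom-∷ʳ u S W)
      ≡⟨ rearrange (sum (map (bin u) W)) (sum (map (bin u ∘ (y ∷_)) W)) (length (filter (_≟C y) S))
                   (sum-binom-∷ʳ u S W) ⟩
    suc (length (filter (_≟C y) S)) * sum (map (bin u) W) + sum-binom-∷ʳ u (y ∷ S) W ∎
    where
    rearrange : ∀ a b n r → a + b + (n * a + r) ≡ suc n * a + (b + r)
    rearrange = solve-∀
  ... | no _ = begin
    sum (map (bin u ∘ (c ∷_)) W) + sum-binom-∷ʳ (y ∷ u) S W
      ≡⟨ cong (sum (map (bin u ∘ (c ∷_)) W) +_) (sum-binom-∷ y u S W) ⟩
    sum (map (bin u ∘ (c ∷_)) W) +
      (length (filter (_≟C y) S) * sum (map (bin u) W) + sum-binom-∷ʳ u S W)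
      ≡⟨ +-comm-middle (sum (map (bin u ∘ (c ∷_)) W)) (length (filter (_≟C y) S) * sum (map (bin u) W))
                       (sum-binom-∷ʳ u S W) ⟩
    length (filter (_≟C y) S) * sum (map (bin u) W) + sum-binom-∷ʳ u (c ∷ S) W ∎
    where
    +-comm-middle : ∀ a b r → a + (b + r) ≡ b + (a + r)
    +-comm-middle = solve-∀

  sum-binom-fibres : ∀ y u b x →
    sum (map (bin (y ∷ u)) (fibres (b ∷ x))) ≡
    length (filter (_≟C y) (fibre b)) * sum (map (bin u) (fibres x)) + sum (map (bin u) (fibres (b ∷ x)))
  sum-binom-fibres y u b x = begin
    sum (map (bin (y ∷ u)) (fibres (b ∷ x)))
      ≡⟨ sum-map-cartesianProduct-∷ (bin (y ∷ u)) (fibre b) (fibres x) ⟩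
    sum-binom-∷ʳ (y ∷ u) (fibre b) (fibres x)
      ≡⟨ sum-binom-∷ y u (fibre b) (fibres x) ⟩
    length (filter (_≟C y) (fibre b)) * sum (map (bin u) (fibres x)) + sum-binom-∷ʳ u (fibre b) (fibres x)
      ≡⟨ cong (length (filter (_≟C y) (fibre b)) * sum (map (bin u) (fibres x)) +_)
              (sym (sum-map-cartesianProduct-∷ (bin u) (fibre b) (fibres x))) ⟩
    length (filter (_≟C y) (fibre b)) * sum (map (bin u) (fibres x)) + sum (map (bin u) (fibres (b ∷ x))) ∎

  binom-map : ∀ u x → binom _≟D_ (map f u) x ≡ sum (map (bin u) (fibres x))
  binom-map u [] = trans (binom-[] _≟D_ (map f u)) (cong (_+ 0) (sym (binom-[] _≟C_ u)))
  binom-map [] (b ∷ x) = sym (begin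
    sum (map (bin []) (fibres (b ∷ x)))
      ≡⟨ sum-map-cartesianProduct-∷ (bin []) (fibre b) (fibres x) ⟩
    sum (map (λ _ → sum (map (λ _ → 0) (fibres x))) (fibre b))
      ≡⟨ cong sum (map-cong (λ _ → sum-map-0 (fibres x)) (fibre b)) ⟩
    sum (map (λ _ → 0) (fibre b))
      ≡⟨ sum-map-0 (fibre b) ⟩
    0 ∎)
  binom-map (y ∷ u) (b ∷ x) with b ≟D f y
  ... | yes refl = begin
    binom _≟D_ (map f u) x + binom _≟D_ (map f u) (f y ∷ x)
      ≡⟨ cong₂ _+_ (trans (binom-map u x) (sym (*-identityˡ _))) (binom-map u (f y ∷ x)) ⟩
    1 * sum (map (bin u) (fibres x)) + sum (map (bin u) (fibres (f y ∷ x)))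
      ≡⟨ cong (λ n → n * sum (map (bin u) (fibres x)) + sum (map (bin u) (fibres (f y ∷ x))))
              (sym (fibre-hit y)) ⟩
    length (filter (_≟C y) (fibre (f y))) * sum (map (bin u) (fibres x)) +
      sum (map (bin u) (fibres (f y ∷ x)))
      ≡⟨ sum-binom-fibres y u (f y) x ⟨
    sum (map (bin (y ∷ u)) (fibres (f y ∷ x))) ∎
  ... | no b≢fy = begin
    binom _≟D_ (map f u) (b ∷ x)
      ≡⟨ binom-map u (b ∷ x) ⟩
    sum (map (bin u) (fibres (b ∷ x)))
      ≡⟨ cong (λ n → n * sum (map (bin u) (fibres x)) + sum (map (bin u) (fibres (b ∷ x))))
              (sym (fibre-miss (≢-sym b≢fy))) ⟩
    length (filter (_≟C y) (fibre b)) * sum (map (bin u) (fibres x)) +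
      sum (map (bin u) (fibres (b ∷ x)))
      ≡⟨ sum-binom-fibres y u b x ⟨
    sum (map (bin (y ∷ u)) (fibres (b ∷ x))) ∎

  map-preserves-binEquiv : ∀ k {u v} → BinEquiv _≟C_ k u v → BinEquiv _≟D_ k (map f u) (map f v)
  map-preserves-binEquiv k {u} {v} u≈v x |x|≤k = begin
    binom _≟D_ (map f u) x        ≡⟨ binom-map u x ⟩
    sum (map (bin u) (fibres x))  ≡⟨ cong sum (map-cong-local (All.map
                                       (λ {z} |z|≡ → u≈v z (subst (_≤ k) (sym |z|≡) |x|≤k))
                                       (length-fibres x))) ⟩
    sum (map (bin v) (fibres x))  ≡⟨ binom-map v x ⟨
    binom _≟D_ (map f v) x        ∎

module _ (_≟A_ : DecidableEquality A) (_≟B_ : DecidableEquality B) where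

  binom-mapMaybe-isInj₂ : ∀ u x →
    binom _≟B_ (mapMaybe isInj₂ u) x ≡ binom (⊎-≡-dec _≟A_ _≟B_) u (map inj₂ x)
  binom-mapMaybe-isInj₂ u [] =
    trans (binom-[] _≟B_ (mapMaybe isInj₂ u)) (sym (binom-[] (⊎-≡-dec _≟A_ _≟B_) u))
  binom-mapMaybe-isInj₂ [] (b ∷ x) = refl
  binom-mapMaybe-isInj₂ (inj₁ _ ∷ u) (b ∷ x) = binom-mapMaybe-isInj₂ u (b ∷ x)
  binom-mapMaybe-isInj₂ (inj₂ c ∷ u) (b ∷ x) with b ≟B c
  ... | yes refl = cong₂ _+_ (binom-mapMaybe-isInj₂ u x) (binom-mapMaybe-isInj₂ u (b ∷ x))
  ... | no _ = binom-mapMaybe-isInj₂ u (b ∷ x)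

  mapMaybe-isInj₂-preserves-binEquiv : ∀ k {u v} → BinEquiv (⊎-≡-dec _≟A_ _≟B_) k u v →
    BinEquiv _≟B_ k (mapMaybe isInj₂ u) (mapMaybe isInj₂ v)
  mapMaybe-isInj₂-preserves-binEquiv k {u} {v} u≈v x |x|≤k =
    trans (binom-mapMaybe-isInj₂ u x)
      (trans (u≈v (map inj₂ x) (subst (_≤ k) (sym (length-map inj₂ x)) |x|≤k))
        (sym (binom-mapMaybe-isInj₂ v x)))

uncolor : A → A ⊎ B → A
uncolor a = [ id , const a ]′

uncolor-isInj₂-injective : (a : A) {u v : List (A ⊎ B)} →
  All (_≢ inj₁ a) u → All (_≢ inj₁ a) v →
  map (uncolor a) u ≡ map (uncolor a) v → mapMaybe isInj₂ u ≡ mapMaybe isInj₂ v → u ≡ v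
uncolor-isInj₂-injective a {[]} {[]} _ _ _ _ = refl
uncolor-isInj₂-injective a {inj₁ x ∷ u} {inj₁ y ∷ v} (_ ∷ u≢a) (_ ∷ v≢a) uncolored≡ erased≡
  with x≡y , uncolored≡′ ← ∷-injective uncolored≡ =
  cong₂ _∷_ (cong inj₁ x≡y) (uncolor-isInj₂-injective a u≢a v≢a uncolored≡′ erased≡)
uncolor-isInj₂-injective a {inj₂ x ∷ u} {inj₂ y ∷ v} (_ ∷ u≢a) (_ ∷ v≢a) uncolored≡ erased≡
  with x≡y , erased≡′ ← ∷-injective erased≡ =
  cong₂ _∷_ (cong inj₂ x≡y)
    (uncolor-isInj₂-injective a u≢a v≢a (proj₂ (∷-injective uncolored≡)) erased≡′)
uncolor-isInj₂-injective a {inj₁ x ∷ u} {inj₂ y ∷ v} (x≢a ∷ _) _ uncolored≡ _ =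
  ⊥-elim (x≢a (cong inj₁ (proj₁ (∷-injective uncolored≡))))
uncolor-isInj₂-injective a {inj₂ x ∷ u} {inj₁ y ∷ v} _ (y≢a ∷ _) uncolored≡ _ =
  ⊥-elim (y≢a (cong inj₁ (sym (proj₁ (∷-injective uncolored≡)))))

module Coloring {p q : ℕ} (w₀ : Word (Fin p)) (a : Fin p) (w₁ : Word (Fin q)) where

  colored : Word (Fin p ⊎ Fin q)
  colored = color w₀ a w₁

  countBefore : ℕ → ℕ
  countBefore zero = 0
  countBefore (suc i) = countUpTo _≟_ w₀ a i

  countUpTo-hit : ∀ i → w₀ i ≡ a → countUpTo _≟_ w₀ a i ≡ suc (countBefore i)
  countUpTo-hit zero w₀i≡a with w₀ zero ≟ a
  ... | yes _ = refl
  ... | no w₀i≢a = ⊥-elim (w₀i≢a w₀i≡a)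
  countUpTo-hit (suc i) w₀i≡a with w₀ (suc i) ≟ a
  ... | yes _ = refl
  ... | no w₀i≢a = ⊥-elim (w₀i≢a w₀i≡a)

  countUpTo-miss : ∀ i → w₀ i ≢ a → countUpTo _≟_ w₀ a i ≡ countBefore i
  countUpTo-miss zero w₀i≢a with w₀ zero ≟ a
  ... | yes w₀i≡a = ⊥-elim (w₀i≢a w₀i≡a)
  ... | no _ = refl
  countUpTo-miss (suc i) w₀i≢a with w₀ (suc i) ≟ a
  ... | yes w₀i≡a = ⊥-elim (w₀i≢a w₀i≡a)
  ... | no _ = refl

  countIn : ℕ → ℕ → ℕ
  countIn i n = length (filter (_≟ a) (factor w₀ i n))

  erase-factor : ∀ i n →
    mapMaybe isInj₂ (factor (colored) i n) ≡ factor w₁ (countBefore i) (countIn i n)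
  erase-factor i zero = refl
  erase-factor i (suc n) with w₀ i ≟ a
  ... | yes w₀i≡a = cong₂ _∷_ (cong (λ m → w₁ (m ∸ 1)) (countUpTo-hit i w₀i≡a))
    (trans (erase-factor (suc i) n) (cong (λ m → factor w₁ m (countIn (suc i) n)) (countUpTo-hit i w₀i≡a)))
  ... | no w₀i≢a = trans (erase-factor (suc i) n)
    (cong (λ m → factor w₁ m (countIn (suc i) n)) (countUpTo-miss i w₀i≢a))

  uncolor-color : ∀ m → uncolor a (colored m) ≡ w₀ m
  uncolor-color m with w₀ m ≟ a
  ... | yes w₀m≡a = sym w₀m≡a
  ... | no _ = refl

  uncolor-factor : ∀ i n → map (uncolor a) (factor (colored) i n) ≡ factor w₀ i n
  uncolor-factor i zero = refl
  uncolor-factor i (suc n) = cong₂ _∷_ (uncolor-color i) (uncolor-factor (suc i) n)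

  color-≢ : ∀ m → colored m ≢ inj₁ a
  color-≢ m with w₀ m ≟ a
  ... | yes _ = λ ()
  ... | no w₀m≢a = λ { refl → w₀m≢a refl }

  factor-color-≢ : ∀ i n → All (_≢ inj₁ a) (factor (colored) i n)
  factor-color-≢ i zero = []
  factor-color-≢ i (suc n) = color-≢ i ∷ factor-color-≢ (suc i) n

  uncolorFibre : Fin p → List (Fin p ⊎ Fin q)
  uncolorFibre b with b ≟ a
  ... | yes _ = inj₁ b ∷ map inj₂ (allFin q)
  ... | no _ = [ inj₁ b ]

  uncolorFibre-unique : ∀ b → Unique (uncolorFibre b)
  uncolorFibre-unique b with b ≟ a
  ... | yes _ = All.map⁺ (All.universal (λ _ ()) (allFin q))
                ∷ Unique.map⁺ inj₂-injective (Unique.allFin⁺ q)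
  ... | no _ = [] ∷ []

  uncolorFibre-sound : ∀ {y b} → y ∈ uncolorFibre b → uncolor a y ≡ b
  uncolorFibre-sound {y} {b} y∈ with b ≟ a | y∈
  ... | yes _ | here refl = refl
  ... | yes b≡a | there y∈inj₂ with _ , _ , refl ← ∈-map⁻ inj₂ y∈inj₂ = sym b≡a
  ... | no _ | here refl = refl

  uncolorFibre-complete : ∀ y → y ∈ uncolorFibre (uncolor a y)
  uncolorFibre-complete (inj₁ b) with b ≟ a
  ... | yes _ = here refl
  ... | no _ = here refl
  uncolorFibre-complete (inj₂ d) with a ≟ a
  ... | yes _ = there (∈-map⁺ inj₂ (∈-allFin d))
  ... | no a≢a = ⊥-elim (a≢a refl)

  open LetterMorphism decSum _≟_ (uncolor a) uncolorFibre
    uncolorFibre-unique uncolorFibre-sound uncolorFibre-complete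
    using (map-preserves-binEquiv)

  color-binInjective : ∀ k → BinInjective _≟_ k w₀ → BinInjective _≟_ k w₁ →
    BinInjective decSum k (colored)
  color-binInjective k w₀-inj w₁-inj n i j u≈v =
    uncolor-isInj₂-injective a (factor-color-≢ i n) (factor-color-≢ j n) uncolored≡ erased≡
    where
    base≡ : factor w₀ i n ≡ factor w₀ j n
    base≡ = w₀-inj n i j (subst₂ (BinEquiv _≟_ k) (uncolor-factor i n) (uncolor-factor j n)
      (map-preserves-binEquiv k u≈v))
    uncolored≡ : map (uncolor a) (factor (colored) i n) ≡ map (uncolor a) (factor (colored) j n)
    uncolored≡ = trans (uncolor-factor i n) (trans base≡ (sym (uncolor-factor j n)))
    m : ℕ
    m = countIn i n
    erased-i : mapMaybe isInj₂ (factor (colored) i n) ≡ factor w₁ (countBefore i) m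
    erased-i = erase-factor i n
    erased-j : mapMaybe isInj₂ (factor (colored) j n) ≡ factor w₁ (countBefore j) m
    erased-j = trans (erase-factor j n)
      (cong (λ u → factor w₁ (countBefore j) (length (filter (_≟ a) u))) (sym base≡))
    erased≡ : mapMaybe isInj₂ (factor (colored) i n) ≡ mapMaybe isInj₂ (factor (colored) j n)
    erased≡ = trans erased-i (trans (w₁-inj m (countBefore i) (countBefore j)
      (subst₂ (BinEquiv _≟_ k) erased-i erased-j (mapMaybe-isInj₂-preserves-binEquiv _≟_ _≟_ k u≈v)))
      (sym erased-j))

-- The argument does not use the hypothesis 0 < k.
lemma3 : {p q : ℕ} (w₀ : Word (Fin p)) (w₁ : Word (Fin q)) (k : ℕ) → 0 < k →
    BinEqSubword _≟_ k w₀ → BinEqSubword _≟_ k w₁ →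
    (a : Fin p) → BinEqSubword decSum k (color w₀ a w₁)
lemma3 w₀ w₁ k _ b=p₀ b=p₁ a =
  binInjective⇒binEqSubword decSum k (color w₀ a w₁)
    (Coloring.color-binInjective w₀ a w₁ k
      (binEqSubword⇒binInjective k w₀ b=p₀) (binEqSubword⇒binInjective k w₁ b=p₁))
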